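{- Let $\delta\in(0,1/2]$ and let $P_1,Q_1,\dots,P_k,Q_k$ be $\delta/8$-placed curves (each $P_\ell,Q_\ell$ pair). Define the points $s_P=(-\delta/2,1-\delta^2)$, $t_P=(\delta/2,1-\delta^2)$, $b_P=(-\delta/2,1)$, $e_P=(\delta/2,1)$, $s_Q=(-\delta/2,\delta^2)$, $t_Q=(\delta/2,\delta^2)$, $s_Q^*=(-\delta/2,-\delta^2)$, $t_Q^*=(\delta/2,-\delta^2)$, $b_Q=(-\delta/2,0)$, $e_Q=(\delta/2,0)$, and the curves $$P:=\bigcirc_{\ell=1}^k\, s_P\circ b_P\circ P_\ell\circ e_P\circ t_P,\qquad Q:=s_Q\circ s_Q^*\circ\Big(\bigcirc_{\ell=1}^k\, b_Q\circ Q_\ell\circ e_Q\Big)\circ t_Q^*\circ t_Q.$$ Then $P,Q$ are $\delta$-placed, and $d_F(P,Q)\le 1$ if and only if there are $1\le i,j\le k$ with $d_F(P_i,Q_j)\le 1$.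
   Context: A curve is a finite sequence of points in $\mathbb{R}^2$; $\circ$ denotes concatenation of sequences. Curves $P,Q$ are $\delta$-placed if all vertices of $P$ and $Q$ have $x$-coordinates in $[-\delta,\delta]$, all vertices of $P$ have $y$-coordinates in $[1-\delta^2,1+\delta^2]$, and all vertices of $Q$ have $y$-coordinates in $[-\delta^2,\delta^2]$. For curves $P=(p_1,\dots,p_n)$, $Q=(q_1,\dots,q_m)$, the discrete Fr\'echet distance $d_F(P,Q)$ is the minimal $\delta'$ for which there are monotone non-decreasing onto maps $\phi:\{1,\dots,n+m\}\to\{1,\dots,n\}$, $\psi:\{1,\dots,n+m\}\to\{1,\dots,m\}$ with $\|p_{\phi(t)}-q_{\psi(t)}\|_2\le\delta'$ for all $t$. -}

module Defs where

open import Level using (0ℓ)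
open import Data.Nat using (ℕ; zero; suc)
open import Data.Fin as Fin using (Fin)
open import Data.Product using (Σ; ∃; _×_; _,_)
open import Data.List using (List; []; _∷_; _++_; length; lookup; concat; tabulate)
open import Data.List.Relation.Unary.All using (All)
open import Relation.Binary.PropositionalEquality using (_≡_)
open import Relation.Binary.Structures using (IsTotalOrder)
open import Algebra.Structures using (IsCommutativeRing)
open import Relation.Nullary using (¬_)

-- An ordered field (with a total inverse function, whose value at 0 is
-- irrelevant).  The real numbers are an instance; we state the lemma for
-- every ordered field since agda-stdlib has no real numbers.
record OrderedField : Set₁ where
  infixl 6 _+_ _-_
  infixl 7 _*_
  infix 4 _≤_ _<_
  field
    Carrier : Set
    _+_ _*_ : Carrier → Carrier → Carrier
    -_ : Carrier → Carrier
    0# 1# : Carrier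
    inv : Carrier → Carrier
    _≤_ : Carrier → Carrier → Set
    isCommutativeRing : IsCommutativeRing _≡_ _+_ _*_ -_ 0# 1#
    0≢1 : ¬ (0# ≡ 1#)
    inv-correct : ∀ x → ¬ (x ≡ 0#) → x * inv x ≡ 1#
    isTotalOrder : IsTotalOrder _≡_ _≤_
    +-mono-≤ : ∀ x y z → x ≤ y → x + z ≤ y + z
    *-nonneg : ∀ x y → 0# ≤ x → 0# ≤ y → 0# ≤ x * y

  _-_ : Carrier → Carrier → Carrier
  x - y = x + (- y)

  _<_ : Carrier → Carrier → Set
  x < y = x ≤ y × ¬ (x ≡ y)

  2# : Carrier
  2# = 1# + 1#

  8# : Carrier
  8# = 2# * 2# * 2#

  half : Carrier → Carrier
  half x = x * inv 2#

  eighth : Carrier → Carrier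
  eighth x = x * inv 8#

  _² : Carrier → Carrier
  x ² = x * x

module _ (F : OrderedField) where
  open OrderedField F

  Point : Set
  Point = Carrier × Carrier

  Curve : Set
  Curve = List Point

  mkPt : Carrier → Carrier → Point
  mkPt x y = x , y

  sqDist : Point → Point → Carrier
  sqDist (x₁ , y₁) (x₂ , y₂) = (x₁ - x₂) ² + (y₁ - y₂) ²

  InBox : Carrier → Carrier → Carrier → Point → Set
  InBox δ ylo yhi (x , y) = (- δ ≤ x × x ≤ δ) × (ylo ≤ y × y ≤ yhi)

  Placed : Carrier → Curve → Curve → Set
  Placed δ P Q = All (InBox δ (1# - δ ²) (1# + δ ²)) P
               × All (InBox δ (- (δ ²)) (δ ²)) Q

  Monotone : ∀ {a b} → (Fin a → Fin b) → Set
  Monotone f = ∀ s t → s Fin.≤ t → f s Fin.≤ f t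

  Onto : ∀ {a b} → (Fin a → Fin b) → Set
  Onto {b = b} f = ∀ (i : Fin b) → ∃ λ t → f t ≡ i

  -- d_F(P,Q) ≤ r  (for r ≥ 0): there exist monotone onto maps
  -- φ : {1..n+m} → {1..n}, ψ : {1..n+m} → {1..m} with
  -- ‖p_φ(t) − q_ψ(t)‖₂ ≤ r for all t, i.e. ‖·‖₂² ≤ r².
  -- Since the minimum in the definition of d_F is over a finite set,
  -- d_F(P,Q) ≤ r holds iff such maps exist.
  DFLe : Curve → Curve → Carrier → Set
  DFLe P Q r =
    Σ (Fin (length P Data.Nat.+ length Q) → Fin (length P)) λ φ →
    Σ (Fin (length P Data.Nat.+ length Q) → Fin (length Q)) λ ψ →
      Monotone φ × Monotone ψ × Onto φ × Onto ψ ×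
      (∀ t → sqDist (lookup P (φ t)) (lookup Q (ψ t)) ≤ r ²)

  module Construction (δ : Carrier) where
    sP tP bP eP sQ tQ sQ* tQ* bQ eQ : Point
    sP  = mkPt (- half δ) (1# - δ ²)
    tP  = mkPt (half δ)   (1# - δ ²)
    bP  = mkPt (- half δ) 1#
    eP  = mkPt (half δ)   1#
    sQ  = mkPt (- half δ) (δ ²)
    tQ  = mkPt (half δ)   (δ ²)
    sQ* = mkPt (- half δ) (- (δ ²))
    tQ* = mkPt (half δ)   (- (δ ²))
    bQ  = mkPt (- half δ) 0#
    eQ  = mkPt (half δ)   0#

    bigP : ∀ {k} → (Fin k → Curve) → Curve
    bigP Ps = concat (tabulate λ ℓ → sP ∷ bP ∷ (Ps ℓ ++ (eP ∷ tP ∷ [])))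

    bigQ : ∀ {k} → (Fin k → Curve) → Curve
    bigQ Qs = sQ ∷ sQ* ∷ (concat (tabulate λ ℓ → bQ ∷ (Qs ℓ ++ (eQ ∷ [])))
                          ++ (tQ* ∷ tQ ∷ []))

module Submission where

-- Along a coupling of P and Q, Q can only
--   enter sQ* while P is at some sP_i, P can only enter bP_i while Q is at
--   some bQ_j, and from (bP_i, bQ_j) the path traverses P_i and Q_j
--   together up to (eP_i, eQ_j).  Conversely a coupling of P_i and Q_j
--   extends to one of P and Q.
-- * `Geometry`: with e = δ/8, the auxiliary vertices at x = ±4e and depth
--   8e = δ, every entry of the pattern, and every bound placing a vertex in
--   its δ-box, is certified, with atoms e, 1 - 16e and the distances of an
--   inner vertex to the sides of its box.

open import Defs
open import Level using (0ℓ)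
open import Data.Nat as ℕ using (ℕ; zero; suc; z≤n; s≤s)
import Data.Nat.Properties as ℕ
open import Data.Integer as ℤ using (ℤ; +_; -[1+_])
import Data.Integer.Properties as ℤ
open import Data.Sign as Sign using (Sign)
open import Data.Fin as Fin using (Fin; zero; suc; toℕ; fromℕ<)
import Data.Fin.Properties as Fin
open import Data.Vec as Vec using (Vec; []; _∷_)
open import Data.Vec.Membership.Propositional.Properties using (∈-lookup)
open import Data.Vec.Relation.Unary.All as VecAll using ([]; _∷_) renaming (All to VecAll)
open import Data.List using (List; []; _∷_; _++_; length; lookup; drop; concat; tabulate)
open import Data.List.Properties using (++-assoc)
open import Data.List.Relation.Unary.All as All using (All; []; _∷_)
open import Data.List.Relation.Unary.All.Properties using (++⁺; concat⁺; tabulate⁺)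
open import Data.Maybe using (Maybe; just; nothing)
open import Data.Product using (Σ; ∃; ∃₂; _×_; _,_; proj₁; proj₂)
open import Data.Sum using (_⊎_; inj₁; inj₂)
open import Data.Empty using (⊥; ⊥-elim)
open import Function using (_∘_)
open import Function.Bundles using (_⇔_; mk⇔)
open import Algebra.Bundles using (CommutativeRing)
import Algebra.Properties.Ring as RingProperties
import Algebra.Properties.AbelianGroup as AbelianGroupProperties
import Algebra.Properties.Semiring.Mult.TCOptimised as Multiples
import Algebra.Solver.Ring as RingSolver
import Algebra.Solver.Ring.AlmostCommutativeRing as ACR
open import Relation.Binary.PropositionalEquality
open import Relation.Binary.Structures using (IsTotalOrder)
open import Relation.Nullary using (¬_; yes; no)

module Arithmetic (F : OrderedField) where
  open OrderedField F public

  commutativeRing : CommutativeRing 0ℓ 0ℓ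
  commutativeRing = record { isCommutativeRing = isCommutativeRing }

  open CommutativeRing commutativeRing public using (*-identityʳ; zeroʳ)
  open CommutativeRing commutativeRing
    using (+-assoc; +-comm; +-identityˡ; +-identityʳ; *-assoc; -‿inverseʳ; zeroˡ; ring; +-abelianGroup)
  open RingProperties ring using (-‿distribˡ-*; -‿distribʳ-*; -‿involutive; -0#≈0#)
  open AbelianGroupProperties +-abelianGroup using () renaming (⁻¹-∙-comm to -‿+-comm)
  open IsTotalOrder isTotalOrder public using (total; antisym)
    renaming (refl to ≤-refl; trans to ≤-trans)
  open Multiples (CommutativeRing.semiring commutativeRing)
    using (1+×; ×-homo-+; ×1-homo-*) renaming (_×_ to _times_)

  ι : ℕ → Carrier
  ι n = n times 1#

  ⟦_⟧ℤ : ℤ → Carrier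
  ⟦ + n ⟧ℤ = ι n
  ⟦ -[1+ n ] ⟧ℤ = - ι (suc n)

  -- ⟦_⟧ℤ is a ring homomorphism, which lets the ring solver normalise
  -- polynomials over F with integer coefficients.
  private
    cancel-1 : ∀ a b → (1# + a) - (1# + b) ≡ a - b
    cancel-1 a b = begin
      (1# + a) + - (1# + b)        ≡⟨ cong (λ z → (1# + a) + z) (sym (-‿+-comm 1# b)) ⟩
      (1# + a) + (- 1# + - b)      ≡⟨ +-assoc 1# a _ ⟩
      1# + (a + (- 1# + - b))      ≡⟨ cong (λ z → 1# + z) (+-comm a _) ⟩
      1# + ((- 1# + - b) + a)      ≡⟨ sym (+-assoc 1# _ a) ⟩
      (1# + (- 1# + - b)) + a      ≡⟨ cong (_+ a) (sym (+-assoc 1# (- 1#) (- b))) ⟩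
      ((1# + - 1#) + - b) + a      ≡⟨ cong (λ z → (z + - b) + a) (-‿inverseʳ 1#) ⟩
      (0# + - b) + a               ≡⟨ cong (_+ a) (+-identityˡ (- b)) ⟩
      - b + a                      ≡⟨ +-comm (- b) a ⟩
      a - b                        ∎
      where open ≡-Reasoning

    ⊖-hom : ∀ m n → ⟦ m ℤ.⊖ n ⟧ℤ ≡ ι m - ι n
    ⊖-hom m zero = begin
      ι m             ≡⟨ sym (+-identityʳ (ι m)) ⟩
      ι m + 0#        ≡⟨ cong (λ z → ι m + z) (sym -0#≈0#) ⟩
      ι m - 0#        ∎
      where open ≡-Reasoning
    ⊖-hom zero (suc n) = sym (+-identityˡ _)
    ⊖-hom (suc m) (suc n) = begin
      ⟦ suc m ℤ.⊖ suc n ⟧ℤ         ≡⟨ cong ⟦_⟧ℤ (ℤ.[1+m]⊖[1+n]≡m⊖n m n) ⟩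
      ⟦ m ℤ.⊖ n ⟧ℤ                 ≡⟨ ⊖-hom m n ⟩
      ι m - ι n                     ≡⟨ sym (cancel-1 (ι m) (ι n)) ⟩
      (1# + ι m) - (1# + ι n)       ≡⟨ sym (cong₂ _-_ (1+× m 1#) (1+× n 1#)) ⟩
      ι (suc m) - ι (suc n)         ∎
      where open ≡-Reasoning

    +-hom : ∀ i j → ⟦ i ℤ.+ j ⟧ℤ ≡ ⟦ i ⟧ℤ + ⟦ j ⟧ℤ
    +-hom (+ m) (+ n) = ×-homo-+ 1# m n
    +-hom (+ m) -[1+ n ] = ⊖-hom m (suc n)
    +-hom -[1+ m ] (+ n) = trans (⊖-hom n (suc m)) (+-comm _ _)
    +-hom -[1+ m ] -[1+ n ] = begin
      - ι (suc (suc (m ℕ.+ n)))        ≡⟨ cong (λ k → - ι k) (sym (ℕ.+-suc (suc m) n)) ⟩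
      - ι (suc m ℕ.+ suc n)            ≡⟨ cong -_ (×-homo-+ 1# (suc m) (suc n)) ⟩
      - (ι (suc m) + ι (suc n))        ≡⟨ sym (-‿+-comm _ _) ⟩
      - ι (suc m) + - ι (suc n)        ∎
      where open ≡-Reasoning

    neg-hom : ∀ i → ⟦ ℤ.- i ⟧ℤ ≡ - ⟦ i ⟧ℤ
    neg-hom (+ zero) = sym -0#≈0#
    neg-hom (+ suc n) = refl
    neg-hom -[1+ n ] = sym (-‿involutive _)

    -- Multiplication: ℤ multiplies signs and absolute values separately.
    signed : Sign → Carrier → Carrier
    signed Sign.+ x = x
    signed Sign.- x = - x

    ◃-hom : ∀ s n → ⟦ s ℤ.◃ n ⟧ℤ ≡ signed s (ι n)
    ◃-hom Sign.+ zero = refl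
    ◃-hom Sign.- zero = sym -0#≈0#
    ◃-hom Sign.+ (suc n) = refl
    ◃-hom Sign.- (suc n) = refl

    signed-* : ∀ s t a b → signed (s Sign.* t) (a * b) ≡ signed s a * signed t b
    signed-* Sign.+ Sign.+ a b = refl
    signed-* Sign.+ Sign.- a b = -‿distribʳ-* a b
    signed-* Sign.- Sign.+ a b = -‿distribˡ-* a b
    signed-* Sign.- Sign.- a b = begin
      a * b            ≡⟨ sym (-‿involutive (a * b)) ⟩
      - - (a * b)      ≡⟨ cong -_ (-‿distribʳ-* a b) ⟩
      - (a * - b)      ≡⟨ -‿distribˡ-* a (- b) ⟩
      - a * - b        ∎
      where open ≡-Reasoning

    signed-abs : ∀ i → signed (ℤ.sign i) (ι ℤ.∣ i ∣) ≡ ⟦ i ⟧ℤ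
    signed-abs (+ n) = refl
    signed-abs -[1+ n ] = refl

    *-hom : ∀ i j → ⟦ i ℤ.* j ⟧ℤ ≡ ⟦ i ⟧ℤ * ⟦ j ⟧ℤ
    *-hom i j = begin
      ⟦ (s Sign.* t) ℤ.◃ (m ℕ.* n) ⟧ℤ      ≡⟨ ◃-hom (s Sign.* t) (m ℕ.* n) ⟩
      signed (s Sign.* t) (ι (m ℕ.* n))   ≡⟨ cong (signed (s Sign.* t)) (×1-homo-* m n) ⟩
      signed (s Sign.* t) (ι m * ι n)     ≡⟨ signed-* s t (ι m) (ι n) ⟩
      signed s (ι m) * signed t (ι n)     ≡⟨ cong₂ _*_ (signed-abs i) (signed-abs j) ⟩
      ⟦ i ⟧ℤ * ⟦ j ⟧ℤ                      ∎
      where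
      open ≡-Reasoning
      s t : Sign
      s = ℤ.sign i
      t = ℤ.sign j
      m n : ℕ
      m = ℤ.∣ i ∣
      n = ℤ.∣ j ∣

    almostCommutativeRing : ACR.AlmostCommutativeRing 0ℓ 0ℓ
    almostCommutativeRing = ACR.fromCommutativeRing commutativeRing

    ℤ-morphism : CommutativeRing.rawRing ℤ.+-*-commutativeRing
                   ACR.-Raw-AlmostCommutative⟶ almostCommutativeRing
    ℤ-morphism = record
      { ⟦_⟧ = ⟦_⟧ℤ ; +-homo = +-hom ; *-homo = *-hom ; -‿homo = neg-hom
      ; 0-homo = refl ; 1-homo = refl }

    ℤ-dec : ∀ i j → Maybe (⟦ i ⟧ℤ ≡ ⟦ j ⟧ℤ)
    ℤ-dec i j with i ℤ.≟ j
    ... | yes i≡j = just (cong ⟦_⟧ℤ i≡j)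
    ... | no _ = nothing

  open RingSolver _ almostCommutativeRing ℤ-morphism ℤ-dec public
    using (Polynomial; ⟦_⟧; ⟦_⟧↓; prove; solve; _:=_; con; var; _:+_; _:*_; _:-_; :-_)

  κ : ∀ {k} → ℕ → Polynomial k
  κ n = con (+ n)

  ≤-by-slack : ∀ {a b} s → a + s ≡ b → 0# ≤ s → a ≤ b
  ≤-by-slack {a} s a+s≡b 0≤s =
    subst₂ _≤_ (+-identityˡ a) (trans (+-comm s a) a+s≡b) (+-mono-≤ 0# s a 0≤s)

  0≤-diff : ∀ {a b} → a ≤ b → 0# ≤ b - a
  0≤-diff {a} {b} a≤b = subst (_≤ b - a) (-‿inverseʳ a) (+-mono-≤ a b (- a) a≤b)

  0≤+ : ∀ {a b} → 0# ≤ a → 0# ≤ b → 0# ≤ a + b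
  0≤+ {a} {b} 0≤a 0≤b =
    ≤-trans 0≤b (subst (_≤ a + b) (+-identityˡ b) (+-mono-≤ 0# a b 0≤a))

  0≤square : ∀ x → 0# ≤ x * x
  0≤square x with total 0# x
  ... | inj₁ 0≤x = *-nonneg x x 0≤x 0≤x
  ... | inj₂ x≤0 = subst (0# ≤_) (solve 1 (λ x → (:- x) :* (:- x) := x :* x) refl x)
                     (*-nonneg _ _ 0≤-x 0≤-x)
    where
    0≤-x : 0# ≤ - x
    0≤-x = subst (0# ≤_) (+-identityˡ (- x)) (0≤-diff x≤0)

  0≤1 : 0# ≤ 1#
  0≤1 = subst (0# ≤_) (*-identityʳ 1#) (0≤square 1#)

  0≤ι : ∀ n → 0# ≤ ι n
  0≤ι zero = ≤-refl
  0≤ι (suc n) = subst (0# ≤_) (sym (1+× n 1#)) (0≤+ 0≤1 (0≤ι n))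

  square-≢0 : ∀ {t} → ¬ t ≡ 0# → ¬ t * t ≡ 0#
  square-≢0 {t} t≢0 t²≡0 = t≢0 (begin
    t                   ≡⟨ sym (*-identityʳ t) ⟩
    t * 1#              ≡⟨ cong (t *_) (sym (inv-correct t t≢0)) ⟩
    t * (t * inv t)     ≡⟨ sym (*-assoc t t (inv t)) ⟩
    (t * t) * inv t     ≡⟨ cong (_* inv t) t²≡0 ⟩
    0# * inv t          ≡⟨ zeroˡ (inv t) ⟩
    0#                  ∎)
    where open ≡-Reasoning

  square-gap : ∀ {s} t → ¬ t ≡ 0# → 1# * 1# + t * t ≤ s → ¬ s ≤ 1# * 1#
  square-gap {s} t t≢0 lower upper = square-≢0 t≢0 (antisym t²≤0 (0≤square t))
    where
    one : Carrier
    one = 1# * 1#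
    t²≤0 : t * t ≤ 0#
    t²≤0 = subst₂ _≤_ (solve 2 (λ o u → (o :+ u :* u) :- o := u :* u) refl one t)
                      (-‿inverseʳ one)
                      (+-mono-≤ _ _ (- one) (≤-trans lower upper))

  -- Nonnegativity certificates: sums of products of numerals and of
  -- "atoms", i.e. quantities known to be nonnegative.
  infixl 6 _⊕_
  infixl 7 _⊗_
  data Certificate (n : ℕ) : Set where
    atom    : Fin n → Certificate n
    num     : ℕ → Certificate n
    _⊕_ _⊗_ : Certificate n → Certificate n → Certificate n

  module Certified {k n} (ρ : Vec Carrier k) (atoms : Vec (Polynomial k) n)
                   (atoms-nonneg : VecAll (λ a → 0# ≤ ⟦ a ⟧ ρ) atoms) where

    ⌜_⌝ : Certificate n → Polynomial k
    ⌜ atom i ⌝ = Vec.lookup atoms i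
    ⌜ num m ⌝  = κ m
    ⌜ c ⊕ d ⌝  = ⌜ c ⌝ :+ ⌜ d ⌝
    ⌜ c ⊗ d ⌝  = ⌜ c ⌝ :* ⌜ d ⌝

    certified-nonneg : ∀ c → 0# ≤ ⟦ ⌜ c ⌝ ⟧ ρ
    certified-nonneg (atom i) = VecAll.lookup atoms-nonneg (∈-lookup i atoms)
    certified-nonneg (num m)  = 0≤ι m
    certified-nonneg (c ⊕ d)  = 0≤+ (certified-nonneg c) (certified-nonneg d)
    certified-nonneg (c ⊗ d)  = *-nonneg _ _ (certified-nonneg c) (certified-nonneg d)

    ≤-by : ∀ p q c → ⟦ p :+ ⌜ c ⌝ ⟧↓ ρ ≡ ⟦ q ⟧↓ ρ → ⟦ p ⟧ ρ ≤ ⟦ q ⟧ ρ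
    ≤-by p q c nf = ≤-by-slack _ (prove ρ (p :+ ⌜ c ⌝) q nf) (certified-nonneg c)

module Couplings (F : OrderedField) (r : OrderedField.Carrier F) where
  open OrderedField F

  Close : Point F → Point F → Set
  Close p q = sqDist F p q ≤ r ²

  -- A coupling of two nonempty curves is a path through the grid of
  -- vertex pairs from the first pair to the last one, advancing in P,
  -- in Q or in both at each step, that only visits Close pairs.
  data Coupling : Curve F → Curve F → Set where
    done  : ∀ {p q} → Close p q → Coupling (p ∷ []) (q ∷ [])
    nextQ : ∀ {p q P Q} → Close p q → Coupling (p ∷ P) Q → Coupling (p ∷ P) (q ∷ Q)
    nextP : ∀ {p q P Q} → Close p q → Coupling P (q ∷ Q) → Coupling (p ∷ P) (q ∷ Q)
    next  : ∀ {p q P Q} → Close p q → Coupling P Q → Coupling (p ∷ P) (q ∷ Q)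

  Coupling₀ : Curve F → Curve F → Set
  Coupling₀ P Q = (P ≡ [] × Q ≡ []) ⊎ Coupling P Q

  close-at-start : ∀ {p q P Q} → Coupling (p ∷ P) (q ∷ Q) → Close p q
  close-at-start (done c) = c
  close-at-start (nextQ c _) = c
  close-at-start (nextP c _) = c
  close-at-start (next c _) = c

  -- From a coupling to the maps φ, ψ of the definition of d_F: the
  -- t-th pair visited by the path (repeating the last one).
  module FromCoupling where
    indexP : ∀ {P Q} → Coupling P Q → ℕ → Fin (length P)
    indexP (done _) t = zero
    indexP (nextQ _ w) zero = zero
    indexP (nextQ _ w) (suc t) = indexP w t
    indexP (nextP _ w) zero = zero
    indexP (nextP _ w) (suc t) = suc (indexP w t)
    indexP (next _ w) zero = zero
    indexP (next _ w) (suc t) = suc (indexP w t)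

    indexQ : ∀ {P Q} → Coupling P Q → ℕ → Fin (length Q)
    indexQ (done _) t = zero
    indexQ (nextQ _ w) zero = zero
    indexQ (nextQ _ w) (suc t) = suc (indexQ w t)
    indexQ (nextP _ w) zero = zero
    indexQ (nextP _ w) (suc t) = indexQ w t
    indexQ (next _ w) zero = zero
    indexQ (next _ w) (suc t) = suc (indexQ w t)

    index-close : ∀ {P Q} (w : Coupling P Q) t →
                  Close (lookup P (indexP w t)) (lookup Q (indexQ w t))
    index-close (done c) t = c
    index-close (nextQ c w) zero = c
    index-close (nextQ c w) (suc t) = index-close w t
    index-close (nextP c w) zero = c
    index-close (nextP c w) (suc t) = index-close w t
    index-close (next c w) zero = c
    index-close (next c w) (suc t) = index-close w t

    indexP-mono : ∀ {P Q} (w : Coupling P Q) {s t} → s ℕ.≤ t →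
                  toℕ (indexP w s) ℕ.≤ toℕ (indexP w t)
    indexP-mono (done _) _ = z≤n
    indexP-mono (nextQ _ w) {zero} _ = z≤n
    indexP-mono (nextQ _ w) {suc s} {suc t} (s≤s s≤t) = indexP-mono w s≤t
    indexP-mono (nextP _ w) {zero} _ = z≤n
    indexP-mono (nextP _ w) {suc s} {suc t} (s≤s s≤t) = s≤s (indexP-mono w s≤t)
    indexP-mono (next _ w) {zero} _ = z≤n
    indexP-mono (next _ w) {suc s} {suc t} (s≤s s≤t) = s≤s (indexP-mono w s≤t)

    indexQ-mono : ∀ {P Q} (w : Coupling P Q) {s t} → s ℕ.≤ t →
                  toℕ (indexQ w s) ℕ.≤ toℕ (indexQ w t)
    indexQ-mono (done _) _ = z≤n
    indexQ-mono (nextQ _ w) {zero} _ = z≤n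
    indexQ-mono (nextQ _ w) {suc s} {suc t} (s≤s s≤t) = s≤s (indexQ-mono w s≤t)
    indexQ-mono (nextP _ w) {zero} _ = z≤n
    indexQ-mono (nextP _ w) {suc s} {suc t} (s≤s s≤t) = indexQ-mono w s≤t
    indexQ-mono (next _ w) {zero} _ = z≤n
    indexQ-mono (next _ w) {suc s} {suc t} (s≤s s≤t) = s≤s (indexQ-mono w s≤t)

    -- A path through the n × m grid has fewer than n + m steps.
    private
      shiftQ : ∀ {t} n m → t ℕ.< n ℕ.+ m → suc t ℕ.< n ℕ.+ suc m
      shiftQ {t} n m t<n+m = subst (suc t ℕ.<_) (sym (ℕ.+-suc n m)) (s≤s t<n+m)

      weakenQ : ∀ {t} n m → t ℕ.< n ℕ.+ m → t ℕ.< n ℕ.+ suc m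
      weakenQ {t} n m t<n+m = ℕ.≤-trans t<n+m (ℕ.+-monoʳ-≤ n (ℕ.n≤1+n m))

    indexP-onto : ∀ {P Q} (w : Coupling P Q) (a : Fin (length P)) →
                  ∃ λ t → t ℕ.< length P ℕ.+ length Q × indexP w t ≡ a
    indexP-onto (done _) zero = 0 , s≤s z≤n , refl
    indexP-onto (nextQ {P = P} {Q} _ w) a with indexP-onto w a
    ... | t , t< , eq = suc t , shiftQ (suc (length P)) (length Q) t< , eq
    indexP-onto (nextP _ w) zero = 0 , s≤s z≤n , refl
    indexP-onto (nextP _ w) (suc a) with indexP-onto w a
    ... | t , t< , eq = suc t , s≤s t< , cong suc eq
    indexP-onto (next _ w) zero = 0 , s≤s z≤n , refl
    indexP-onto (next {P = P} {Q} _ w) (suc a) with indexP-onto w a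
    ... | t , t< , eq = suc t , s≤s (weakenQ (length P) (length Q) t<) , cong suc eq

    indexQ-onto : ∀ {P Q} (w : Coupling P Q) (b : Fin (length Q)) →
                  ∃ λ t → t ℕ.< length P ℕ.+ length Q × indexQ w t ≡ b
    indexQ-onto (done _) zero = 0 , s≤s z≤n , refl
    indexQ-onto (nextQ _ w) zero = 0 , s≤s z≤n , refl
    indexQ-onto (nextQ {P = P} {Q} _ w) (suc b) with indexQ-onto w b
    ... | t , t< , eq = suc t , shiftQ (suc (length P)) (length Q) t< , cong suc eq
    indexQ-onto (nextP _ w) b with indexQ-onto w b
    ... | t , t< , eq = suc t , s≤s t< , eq
    indexQ-onto (next _ w) zero = 0 , s≤s z≤n , refl
    indexQ-onto (next {P = P} {Q} _ w) (suc b) with indexQ-onto w b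
    ... | t , t< , eq = suc t , s≤s (weakenQ (length P) (length Q) t<) , cong suc eq

  coupling⇒DFLe : ∀ {P Q} → Coupling₀ P Q → DFLe F P Q r
  coupling⇒DFLe (inj₁ (refl , refl)) = (λ ()) , (λ ()) , (λ ()) , (λ ()) , (λ ()) , (λ ()) , (λ ())
  coupling⇒DFLe (inj₂ w) =
    (λ t → indexP w (toℕ t)) , (λ t → indexQ w (toℕ t)) ,
    (λ _ _ s≤t → indexP-mono w s≤t) , (λ _ _ s≤t → indexQ-mono w s≤t) ,
    (λ a → let (t , t< , eq) = indexP-onto w a
           in fromℕ< t< , trans (cong (indexP w) (Fin.toℕ-fromℕ< t<)) eq) ,
    (λ b → let (t , t< , eq) = indexQ-onto w b
           in fromℕ< t< , trans (cong (indexQ w) (Fin.toℕ-fromℕ< t<)) eq) ,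
    (λ t → index-close w (toℕ t))
    where open FromCoupling

  module ToCoupling where
    -- The vertex at a position of a curve (a default vertex beyond its end).
    vertex : Curve F → ℕ → Point F
    vertex [] _ = 0# , 0#
    vertex (p ∷ P) zero = p
    vertex (p ∷ P) (suc a) = vertex P a

    vertex-lookup : ∀ P (a : Fin (length P)) → vertex P (toℕ a) ≡ lookup P a
    vertex-lookup (p ∷ P) zero = refl
    vertex-lookup (p ∷ P) (suc a) = vertex-lookup P a

    drop-vertex : ∀ P {a} → a ℕ.< length P → drop a P ≡ vertex P a ∷ drop (suc a) P
    drop-vertex (p ∷ P) {zero} _ = refl
    drop-vertex (p ∷ P) {suc a} (s≤s a<) = drop-vertex P a<

    drop-last : ∀ P {a} → suc a ≡ length P → drop a P ≡ vertex P a ∷ []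
    drop-last P {a} 1+a≡len = trans (drop-vertex P (ℕ.≤-reflexive 1+a≡len))
      (cong (vertex P a ∷_) (trans (cong (λ b → drop b P) 1+a≡len) (drop-all P)))
      where
      drop-all : ∀ P → drop (length P) P ≡ []
      drop-all [] = refl
      drop-all (_ ∷ P) = drop-all P

    module MonotoneOnto {N n} (φ : Fin N → Fin n)
                        (mono : Monotone F φ) (onto : Onto F φ) where
      unit-step : ∀ a b → toℕ b ≡ suc (toℕ a) →
                  toℕ (φ b) ≡ toℕ (φ a) ⊎ toℕ (φ b) ≡ suc (toℕ (φ a))
      unit-step a b b≡1+a with ℕ.m≤n⇒m<n∨m≡n (mono a b (subst (toℕ a ℕ.≤_) (sym b≡1+a) (ℕ.n≤1+n _)))
                              | toℕ (φ b) ℕ.≤? suc (toℕ (φ a))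
      ... | inj₂ φa≡φb | _ = inj₁ (sym φa≡φb)
      ... | inj₁ φa<φb | yes φb≤1+φa = inj₂ (ℕ.≤-antisym φb≤1+φa φa<φb)
      ... | _ | no φb≰1+φa = ⊥-elim (value-skipped (onto middle))
        where
        -- the value 1 + φ a lies strictly between φ a and φ b, so it is not hit
        1+φa<n : suc (toℕ (φ a)) ℕ.< n
        1+φa<n = ℕ.≤-trans (ℕ.≰⇒> φb≰1+φa) (ℕ.<⇒≤ (Fin.toℕ<n (φ b)))
        middle : Fin n
        middle = fromℕ< 1+φa<n
        toℕ-middle : toℕ middle ≡ suc (toℕ (φ a))
        toℕ-middle = Fin.toℕ-fromℕ< 1+φa<n
        value-skipped : (∃ λ s → φ s ≡ middle) → ⊥
        value-skipped (s , φs≡middle) with toℕ s ℕ.≤? toℕ a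
        ... | yes s≤a = ℕ.<-irrefl refl (ℕ.≤-trans
              (ℕ.≤-reflexive (trans (sym toℕ-middle) (cong toℕ (sym φs≡middle)))) (mono s a s≤a))
        ... | no s≰a = φb≰1+φa (ℕ.≤-trans
              (mono b s (subst (ℕ._≤ toℕ s) (sym b≡1+a) (ℕ.≰⇒> s≰a)))
              (ℕ.≤-reflexive (trans (cong toℕ φs≡middle) toℕ-middle)))

      starts-at-0 : ∀ a → toℕ a ≡ 0 → n ℕ.> 0 → toℕ (φ a) ≡ 0
      starts-at-0 a a≡0 n>0 with onto (fromℕ< n>0)
      ... | s , φs≡0 = ℕ.n≤0⇒n≡0 (ℕ.≤-trans (mono a s (subst (ℕ._≤ toℕ s) (sym a≡0) z≤n))
                                     (ℕ.≤-reflexive (trans (cong toℕ φs≡0) (Fin.toℕ-fromℕ< n>0))))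

      ends-at-last : ∀ N' n' → suc N' ≡ N → suc n' ≡ n → ∀ b → toℕ b ≡ N' → toℕ (φ b) ≡ n'
      ends-at-last N' n' refl refl b b≡N' with onto (Fin.fromℕ n')
      ... | s , φs≡last = ℕ.≤-antisym (ℕ.≤-pred (Fin.toℕ<n (φ b)))
            (ℕ.≤-trans (ℕ.≤-reflexive (trans (sym (Fin.toℕ-fromℕ n')) (cong toℕ (sym φs≡last))))
               (mono s b (subst (toℕ s ℕ.≤_) (sym b≡N') (ℕ.≤-pred (Fin.toℕ<n s)))))

    module FromIndexSequences (P Q : Curve F) (f g : ℕ → ℕ) (T : ℕ)
      (f-step : ∀ t → t ℕ.< T → f (suc t) ≡ f t ⊎ f (suc t) ≡ suc (f t))
      (g-step : ∀ t → t ℕ.< T → g (suc t) ≡ g t ⊎ g (suc t) ≡ suc (g t))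
      (f-end : suc (f T) ≡ length P) (g-end : suc (g T) ≡ length Q)
      (f< : ∀ t → f t ℕ.< length P) (g< : ∀ t → g t ℕ.< length Q)
      (close : ∀ t → Close (vertex P (f t)) (vertex Q (g t))) where

      suffix-P : ∀ t → drop (f t) P ≡ vertex P (f t) ∷ drop (suc (f t)) P
      suffix-P t = drop-vertex P (f< t)

      suffix-Q : ∀ t → drop (g t) Q ≡ vertex Q (g t) ∷ drop (suc (g t)) Q
      suffix-Q t = drop-vertex Q (g< t)

      from-t : ∀ {t} → Coupling (vertex P (f t) ∷ drop (suc (f t)) P) (vertex Q (g t) ∷ drop (suc (g t)) Q) →
               Coupling (drop (f t) P) (drop (g t) Q)
      from-t {t} = subst₂ Coupling (sym (suffix-P t)) (sym (suffix-Q t))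

      extend : ∀ t → t ℕ.< T → Coupling (drop (f (suc t)) P) (drop (g (suc t)) Q) →
               Coupling (drop (f t) P) (drop (g t) Q)
      extend t t<T w with f-step t t<T | g-step t t<T
      ... | inj₁ f≡ | inj₁ g≡ = subst₂ Coupling (cong (λ a → drop a P) f≡) (cong (λ b → drop b Q) g≡) w
      ... | inj₁ f≡ | inj₂ g≡ = from-t (nextQ (close t)
            (subst₂ Coupling (trans (cong (λ a → drop a P) f≡) (suffix-P t)) (cong (λ b → drop b Q) g≡) w))
      ... | inj₂ f≡ | inj₁ g≡ = from-t (nextP (close t)
            (subst₂ Coupling (cong (λ a → drop a P) f≡) (trans (cong (λ b → drop b Q) g≡) (suffix-Q t)) w))
      ... | inj₂ f≡ | inj₂ g≡ = from-t (next (close t)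
            (subst₂ Coupling (cong (λ a → drop a P) f≡) (cong (λ b → drop b Q) g≡) w))

      coupling-from : ∀ k t → t ℕ.+ k ≡ T → Coupling (drop (f t) P) (drop (g t) Q)
      coupling-from zero t t+0≡T with trans (sym (ℕ.+-identityʳ t)) t+0≡T
      ... | refl = subst₂ Coupling (sym (drop-last P f-end)) (sym (drop-last Q g-end)) (done (close t))
      coupling-from (suc k) t t+k+1≡T =
        extend t t<T (coupling-from k (suc t) (trans (sym (ℕ.+-suc t k)) t+k+1≡T))
        where
        t<T : t ℕ.< T
        t<T = subst (t ℕ.<_) t+k+1≡T (ℕ.m<m+n t (s≤s z≤n))

    -- Fin (suc N) as the initial segment 0..N of ℕ, truncating larger values.
    clamp : ∀ N → ℕ → Fin (suc N)
    clamp N zero = zero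
    clamp zero (suc t) = zero
    clamp (suc N) (suc t) = suc (clamp N t)

    toℕ-clamp : ∀ N t → t ℕ.≤ N → toℕ (clamp N t) ≡ t
    toℕ-clamp N zero _ = refl
    toℕ-clamp (suc N) (suc t) (s≤s t≤N) = cong suc (toℕ-clamp N t t≤N)

  DFLe⇒coupling : ∀ P Q → DFLe F P Q r → Coupling₀ P Q
  DFLe⇒coupling [] [] _ = inj₁ (refl , refl)
  DFLe⇒coupling [] (q ∷ Q) (φ , _) with φ zero
  ... | ()
  DFLe⇒coupling (p ∷ P) [] (φ , ψ , _) with ψ zero
  ... | ()
  DFLe⇒coupling (p ∷ P) (q ∷ Q) (φ , ψ , φ-mono , ψ-mono , φ-onto , ψ-onto , close) =
    inj₂ (subst₂ Coupling (cong (λ a → drop a (p ∷ P)) f0) (cong (λ b → drop b (q ∷ Q)) g0)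
           (Sequences.coupling-from T 0 refl))
    where
    open ToCoupling
    -- the last index of Fin (length (p ∷ P) + length (q ∷ Q))
    T : ℕ
    T = length P ℕ.+ suc (length Q)
    module MP = MonotoneOnto φ φ-mono φ-onto
    module MQ = MonotoneOnto ψ ψ-mono ψ-onto
    f g : ℕ → ℕ
    f t = toℕ (φ (clamp T t))
    g t = toℕ (ψ (clamp T t))
    clamp-step : ∀ t → t ℕ.< T → toℕ (clamp T (suc t)) ≡ suc (toℕ (clamp T t))
    clamp-step t t<T = trans (toℕ-clamp T (suc t) t<T) (cong suc (sym (toℕ-clamp T t (ℕ.<⇒≤ t<T))))
    last-T : toℕ (clamp T T) ≡ T
    last-T = toℕ-clamp T T ℕ.≤-refl
    module Sequences = FromIndexSequences (p ∷ P) (q ∷ Q) f g T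
      (λ t t<T → MP.unit-step (clamp T t) (clamp T (suc t)) (clamp-step t t<T))
      (λ t t<T → MQ.unit-step (clamp T t) (clamp T (suc t)) (clamp-step t t<T))
      (cong suc (MP.ends-at-last T (length P) refl refl (clamp T T) last-T))
      (cong suc (MQ.ends-at-last T (length Q) refl refl (clamp T T) last-T))
      (λ t → Fin.toℕ<n _) (λ t → Fin.toℕ<n _)
      (λ t → subst₂ Close (sym (vertex-lookup (p ∷ P) (φ (clamp T t))))
                          (sym (vertex-lookup (q ∷ Q) (ψ (clamp T t)))) (close (clamp T t)))
    f0 : f 0 ≡ 0
    f0 = MP.starts-at-0 zero refl (s≤s z≤n)
    g0 : g 0 ≡ 0
    g0 = MQ.starts-at-0 zero refl (s≤s z≤n)

split-blocks : ∀ {a p} {A : Set a} {Pr : A → Set p} {k} (f : Fin k → List A) →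
  (∀ ℓ → All Pr (f ℓ)) → (i : Fin k) →
  Σ (List A) λ pre → Σ (List A) λ post →
    (concat (tabulate f) ≡ pre ++ (f i ++ post)) × All Pr pre × All Pr post
split-blocks f all-f zero = [] , _ , refl , [] , concat⁺ (tabulate⁺ (all-f ∘ suc))
split-blocks f all-f (suc i) with split-blocks (f ∘ suc) (all-f ∘ suc) i
... | pre , post , eq , all-pre , all-post = f zero ++ pre , post ,
      trans (cong (f zero ++_) eq) (sym (++-assoc (f zero) pre _)) , ++⁺ (all-f zero) all-pre , all-post

-- The curves of the construction, for arbitrary auxiliary vertices, and
-- the reduction d_F(P, Q) ≤ 1 ⇔ ∃ i j. d_F(P_i, Q_j) ≤ 1, assuming only a
-- pattern of closeness among the auxiliary and the inner vertices.
module Gadget (F : OrderedField) (sP tP bP eP sQ tQ sQ* tQ* bQ eQ : Point F) where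
  open OrderedField F using (1#)
  open Couplings F 1#

  bigP : ∀ {k} → (Fin k → Curve F) → Curve F
  bigP Ps = concat (tabulate λ ℓ → sP ∷ bP ∷ (Ps ℓ ++ (eP ∷ tP ∷ [])))

  middleQ : ∀ {k} → (Fin k → Curve F) → Curve F
  middleQ Qs = concat (tabulate λ ℓ → bQ ∷ (Qs ℓ ++ (eQ ∷ [])))

  endQ : Curve F
  endQ = tQ* ∷ tQ ∷ []

  bigQ : ∀ {k} → (Fin k → Curve F) → Curve F
  bigQ Qs = sQ ∷ sQ* ∷ (middleQ Qs ++ endQ)

  record Pattern (InP InQ : Point F → Set) : Set where
    field
      bP≁sQ* : ¬ Close bP sQ*
      eP≁sQ* : ¬ Close eP sQ*
      tP≁sQ* : ¬ Close tP sQ*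
      p≁sQ*  : ∀ {p} → InP p → ¬ Close p sQ*
      sP≁tQ* : ¬ Close sP tQ*
      bP≁tQ* : ¬ Close bP tQ*
      bP≁q   : ∀ {q} → InQ q → ¬ Close bP q
      bP≁eQ  : ¬ Close bP eQ
      p≁bQ   : ∀ {p} → InP p → ¬ Close p bQ
      p≁eQ   : ∀ {p} → InP p → ¬ Close p eQ
      eP≁bQ  : ¬ Close eP bQ
      eP≁q   : ∀ {q} → InQ q → ¬ Close eP q
      sP∼sQ : Close sP sQ
      bP∼sQ : Close bP sQ
      eP∼sQ : Close eP sQ
      tP∼sQ : Close tP sQ
      p∼sQ  : ∀ {p} → InP p → Close p sQ
      sP∼tQ : Close sP tQ
      bP∼tQ : Close bP tQ
      eP∼tQ : Close eP tQ
      tP∼tQ : Close tP tQ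
      p∼tQ  : ∀ {p} → InP p → Close p tQ
      sP∼bQ : Close sP bQ
      sP∼eQ : Close sP eQ
      sP∼q  : ∀ {q} → InQ q → Close sP q
      tP∼bQ : Close tP bQ
      tP∼eQ : Close tP eQ
      tP∼q  : ∀ {q} → InQ q → Close tP q
      sP∼sQ* : Close sP sQ*
      tP∼tQ* : Close tP tQ*
      bP∼bQ  : Close bP bQ
      eP∼eQ  : Close eP eQ

  append : ∀ {A B C D} → Coupling A B → Coupling C D → Coupling (A ++ C) (B ++ D)
  append (done c) w′ = next c w′
  append (nextQ c w) w′ = nextQ c (append w w′)
  append (nextP c w) w′ = nextP c (append w w′)
  append (next c w) w′ = next c (append w w′)

  append₀ : ∀ {A B C D} → Coupling₀ A B → Coupling C D → Coupling (A ++ C) (B ++ D)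
  append₀ (inj₁ (refl , refl)) w′ = w′
  append₀ (inj₂ w) w′ = append w w′

  run-Q : ∀ {p P Q} Y → All (Close p) Y → Coupling (p ∷ P) Q → Coupling (p ∷ P) (Y ++ Q)
  run-Q [] _ w = w
  run-Q (y ∷ Y) (c ∷ cs) w = nextQ c (run-Q Y cs w)

  run-P : ∀ {q P Q} X → All (λ x → Close x q) X → Coupling P (q ∷ Q) → Coupling (X ++ P) (q ∷ Q)
  run-P [] _ w = w
  run-P (x ∷ X) (c ∷ cs) w = nextP c (run-P X cs w)

  run-P-to-end : ∀ {q} p P → Close p q → All (λ x → Close x q) P → Coupling (p ∷ P) (q ∷ [])
  run-P-to-end p [] c _ = done c
  run-P-to-end p (p′ ∷ P) c (c′ ∷ cs) = nextP c (run-P-to-end p′ P c′ cs)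

  module _ {InP InQ : Point F → Set} (closeness : Pattern InP InQ) where
    open Pattern closeness

    private
      ++-gadgetP : ∀ {k} (Ps : Fin (suc k) → Curve F) →
        bigP Ps ≡ sP ∷ bP ∷ (Ps zero ++ eP ∷ tP ∷ bigP {k} (Ps ∘ suc))
      ++-gadgetP {k} Ps = cong (λ L → sP ∷ bP ∷ L) (++-assoc (Ps zero) (eP ∷ tP ∷ []) (bigP {k} (Ps ∘ suc)))

    at-sQ* : ∀ {k} (Ps : Fin k → Curve F) X R → All (λ x → ¬ Close x sQ*) X →
             Coupling (X ++ bigP Ps) (sQ* ∷ R) →
             ∃₂ λ i R₁ → Coupling (sP ∷ bP ∷ (Ps i ++ eP ∷ R₁)) (sQ* ∷ R)
    at-sQ* Ps (x ∷ X) R (x≁ ∷ _) w = ⊥-elim (x≁ (close-at-start w))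
    at-sQ* {zero} Ps [] R _ ()
    at-sQ* {suc k} Ps [] R _ w = zero , tP ∷ bigP (Ps ∘ suc) , subst (λ L → Coupling L (sQ* ∷ R)) (++-gadgetP Ps) w

    enter-sQ* : ∀ {k} (Ps : Fin k → Curve F) → (∀ ℓ → All InP (Ps ℓ)) →
                ∀ X R → All (λ x → ¬ Close x sQ*) X → Coupling (X ++ bigP Ps) (sQ ∷ sQ* ∷ R) →
                ∃₂ λ i R₁ → Coupling (sP ∷ bP ∷ (Ps i ++ eP ∷ R₁)) (sQ* ∷ R)
    enter-sQ* Ps inner (x ∷ X) R X≁ (nextQ _ w) = at-sQ* Ps (x ∷ X) R X≁ w
    enter-sQ* Ps inner (x ∷ X) R (_ ∷ X≁) (nextP _ w) = enter-sQ* Ps inner X R X≁ w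
    enter-sQ* Ps inner (x ∷ X) R (_ ∷ X≁) (next _ w) = at-sQ* Ps X R X≁ w
    enter-sQ* {zero} Ps inner [] R _ ()
    enter-sQ* {suc k} Ps inner [] R _ (nextQ _ w) =
      zero , tP ∷ bigP (Ps ∘ suc) , subst (λ L → Coupling L (sQ* ∷ R)) (++-gadgetP Ps) w
    enter-sQ* {suc k} Ps inner [] R _ (nextP _ w)
      with enter-sQ* (Ps ∘ suc) (inner ∘ suc) (bP ∷ (Ps zero ++ eP ∷ tP ∷ [])) R
             (bP≁sQ* ∷ ++⁺ (All.map p≁sQ* (inner zero)) (eP≁sQ* ∷ tP≁sQ* ∷ [])) w
    ... | i , R₁ , w′ = suc i , R₁ , w′
    enter-sQ* {suc k} Ps inner [] R _ (next _ w) = ⊥-elim (bP≁sQ* (close-at-start w))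

    private
      ++-gadgetQ : ∀ (A C D : Curve F) → ((A ++ eQ ∷ []) ++ C) ++ D ≡ A ++ eQ ∷ (C ++ D)
      ++-gadgetQ A C D = trans (++-assoc (A ++ eQ ∷ []) C D) (++-assoc A (eQ ∷ []) (C ++ D))

    at-bQ : ∀ {k} (Qs : Fin k → Curve F) T Z → All (λ z → ¬ Close bP z) Z →
            Coupling (bP ∷ T) ((Z ++ middleQ Qs) ++ endQ) →
            ∃₂ λ j R₂ → Coupling (bP ∷ T) (bQ ∷ (Qs j ++ eQ ∷ R₂))
    at-bQ Qs T (z ∷ Z) (z≁ ∷ _) w = ⊥-elim (z≁ (close-at-start w))
    at-bQ {zero} Qs T [] _ w = ⊥-elim (bP≁tQ* (close-at-start w))
    at-bQ {suc k} Qs T [] _ w = zero , middleQ (Qs ∘ suc) ++ endQ ,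
      subst (λ L → Coupling (bP ∷ T) (bQ ∷ L)) (++-gadgetQ (Qs zero) (middleQ (Qs ∘ suc)) endQ) w

    enter-bP : ∀ {k} (Qs : Fin k → Curve F) → (∀ ℓ → All InQ (Qs ℓ)) →
               ∀ T Z → All (λ z → ¬ Close bP z) Z → Coupling (sP ∷ bP ∷ T) ((Z ++ middleQ Qs) ++ endQ) →
               ∃₂ λ j R₂ → Coupling (bP ∷ T) (bQ ∷ (Qs j ++ eQ ∷ R₂))
    enter-bP Qs inner T (z ∷ Z) (_ ∷ Z≁) (nextQ _ w) = enter-bP Qs inner T Z Z≁ w
    enter-bP Qs inner T (z ∷ Z) (z≁ ∷ _) (nextP _ w) = ⊥-elim (z≁ (close-at-start w))
    enter-bP Qs inner T (z ∷ Z) (_ ∷ Z≁) (next _ w) = at-bQ Qs T Z Z≁ w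
    enter-bP {zero} Qs inner T [] _ w = ⊥-elim (sP≁tQ* (close-at-start w))
    enter-bP {suc k} Qs inner T [] _ (nextQ _ w)
      with enter-bP (Qs ∘ suc) (inner ∘ suc) T (Qs zero ++ eQ ∷ [])
             (++⁺ (All.map bP≁q (inner zero)) (bP≁eQ ∷ [])) w
    ... | j , R₂ , w′ = suc j , R₂ , w′
    enter-bP {suc k} Qs inner T [] _ (nextP _ w) = zero , middleQ (Qs ∘ suc) ++ endQ ,
      subst (λ L → Coupling (bP ∷ T) (bQ ∷ L)) (++-gadgetQ (Qs zero) (middleQ (Qs ∘ suc)) endQ) w
    enter-bP {suc k} Qs inner T [] _ (next _ w)
      with at-bQ (Qs ∘ suc) T (Qs zero ++ eQ ∷ []) (++⁺ (All.map bP≁q (inner zero)) (bP≁eQ ∷ [])) w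
    ... | j , R₂ , w′ = suc j , R₂ , w′

    sQ*-to-bQ : ∀ {k} (Qs : Fin k → Curve F) → (∀ ℓ → All InQ (Qs ℓ)) →
                ∀ T → Coupling (sP ∷ bP ∷ T) (sQ* ∷ (middleQ Qs ++ endQ)) →
                ∃₂ λ j R₂ → Coupling (bP ∷ T) (bQ ∷ (Qs j ++ eQ ∷ R₂))
    sQ*-to-bQ Qs inner T (nextQ _ w) = enter-bP Qs inner T [] [] w
    sQ*-to-bQ Qs inner T (nextP _ w) = ⊥-elim (bP≁sQ* (close-at-start w))
    sQ*-to-bQ Qs inner T (next _ w) = at-bQ Qs T [] [] w

    restrict : ∀ a A b B R₁ R₂ → All InP (a ∷ A) → All InQ (b ∷ B) →
               Coupling ((a ∷ A) ++ eP ∷ R₁) ((b ∷ B) ++ eQ ∷ R₂) → Coupling (a ∷ A) (b ∷ B)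
    restrict a [] b [] R₁ R₂ _ _ w = done (close-at-start w)
    restrict a [] b (b′ ∷ B) R₁ R₂ inA (_ ∷ inB) (nextQ c w) = nextQ c (restrict a [] b′ B R₁ R₂ inA inB w)
    restrict a [] b (b′ ∷ B) R₁ R₂ _ (inb ∷ _) (nextP _ w) = ⊥-elim (eP≁q inb (close-at-start w))
    restrict a [] b (b′ ∷ B) R₁ R₂ _ (_ ∷ inb′ ∷ _) (next _ w) = ⊥-elim (eP≁q inb′ (close-at-start w))
    restrict a (a′ ∷ A) b [] R₁ R₂ (ina ∷ _) _ (nextQ _ w) = ⊥-elim (p≁eQ ina (close-at-start w))
    restrict a (a′ ∷ A) b [] R₁ R₂ (_ ∷ inA) inB (nextP c w) = nextP c (restrict a′ A b [] R₁ R₂ inA inB w)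
    restrict a (a′ ∷ A) b [] R₁ R₂ (_ ∷ ina′ ∷ _) _ (next _ w) = ⊥-elim (p≁eQ ina′ (close-at-start w))
    restrict a (a′ ∷ A) b (b′ ∷ B) R₁ R₂ inA (_ ∷ inB) (nextQ c w) =
      nextQ c (restrict a (a′ ∷ A) b′ B R₁ R₂ inA inB w)
    restrict a (a′ ∷ A) b (b′ ∷ B) R₁ R₂ (_ ∷ inA) inB (nextP c w) =
      nextP c (restrict a′ A b (b′ ∷ B) R₁ R₂ inA inB w)
    restrict a (a′ ∷ A) b (b′ ∷ B) R₁ R₂ (_ ∷ inA) (_ ∷ inB) (next c w) =
      next c (restrict a′ A b′ B R₁ R₂ inA inB w)

    bQ-to-inner : ∀ A B R₁ R₂ → All InP A → All InQ B →
                  Coupling (bP ∷ (A ++ eP ∷ R₁)) (bQ ∷ (B ++ eQ ∷ R₂)) → Coupling₀ A B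
    bQ-to-inner [] [] R₁ R₂ _ _ _ = inj₁ (refl , refl)
    bQ-to-inner [] (b ∷ B) R₁ R₂ _ (inb ∷ _) (nextQ _ w) = ⊥-elim (bP≁q inb (close-at-start w))
    bQ-to-inner [] (b ∷ B) R₁ R₂ _ _ (nextP _ w) = ⊥-elim (eP≁bQ (close-at-start w))
    bQ-to-inner [] (b ∷ B) R₁ R₂ _ (inb ∷ _) (next _ w) = ⊥-elim (eP≁q inb (close-at-start w))
    bQ-to-inner (a ∷ A) [] R₁ R₂ _ _ (nextQ _ w) = ⊥-elim (bP≁eQ (close-at-start w))
    bQ-to-inner (a ∷ A) [] R₁ R₂ (ina ∷ _) _ (nextP _ w) = ⊥-elim (p≁bQ ina (close-at-start w))
    bQ-to-inner (a ∷ A) [] R₁ R₂ (ina ∷ _) _ (next _ w) = ⊥-elim (p≁eQ ina (close-at-start w))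
    bQ-to-inner (a ∷ A) (b ∷ B) R₁ R₂ _ (inb ∷ _) (nextQ _ w) = ⊥-elim (bP≁q inb (close-at-start w))
    bQ-to-inner (a ∷ A) (b ∷ B) R₁ R₂ (ina ∷ _) _ (nextP _ w) = ⊥-elim (p≁bQ ina (close-at-start w))
    bQ-to-inner (a ∷ A) (b ∷ B) R₁ R₂ inA inB (next _ w) = inj₂ (restrict a A b B R₁ R₂ inA inB w)

    couple-inner : ∀ {k} (Ps Qs : Fin k → Curve F) → (∀ ℓ → All InP (Ps ℓ)) → (∀ ℓ → All InQ (Qs ℓ)) →
                   Coupling (bigP Ps) (bigQ Qs) → ∃₂ λ i j → Coupling₀ (Ps i) (Qs j)
    couple-inner Ps Qs innerP innerQ w with enter-sQ* Ps innerP [] (middleQ Qs ++ endQ) [] w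
    ... | i , R₁ , w₁ with sQ*-to-bQ Qs innerQ (Ps i ++ eP ∷ R₁) w₁
    ... | j , R₂ , w₂ = i , j , bQ-to-inner (Ps i) (Qs j) R₁ R₂ (innerP i) (innerQ j) w₂

    P-block∼ : ∀ {A} → All InP A → All (λ x → Close x sQ × Close x tQ) (sP ∷ bP ∷ (A ++ eP ∷ tP ∷ []))
    P-block∼ inA = (sP∼sQ , sP∼tQ) ∷ (bP∼sQ , bP∼tQ) ∷
      ++⁺ (All.map (λ p → p∼sQ p , p∼tQ p) inA) ((eP∼sQ , eP∼tQ) ∷ (tP∼sQ , tP∼tQ) ∷ [])

    Q-block∼ : ∀ {B} → All InQ B → All (λ y → Close sP y × Close tP y) (bQ ∷ (B ++ eQ ∷ []))
    Q-block∼ inB = (sP∼bQ , tP∼bQ) ∷ ++⁺ (All.map (λ q → sP∼q q , tP∼q q) inB) ((sP∼eQ , tP∼eQ) ∷ [])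

    -- P walks to sP_i while Q waits at sQ; Q walks
    -- to bQ_j while P waits at sP_i; both enter the inner curves, follow the
    -- given coupling and meet at (eP_i, eQ_j); Q walks to tQ* while P waits
    -- at tP_i, and finally P walks to its end while Q waits at tQ.
    couple-outer : ∀ {k} (Ps Qs : Fin k → Curve F) → (∀ ℓ → All InP (Ps ℓ)) → (∀ ℓ → All InQ (Qs ℓ)) →
                   ∀ i j → Coupling₀ (Ps i) (Qs j) → Coupling (bigP Ps) (bigQ Qs)
    couple-outer Ps Qs innerP innerQ i j w
      with split-blocks _ (P-block∼ ∘ innerP) i | split-blocks _ (Q-block∼ ∘ innerQ) j
    ... | preP , postP , splitP , preP∼ , postP∼ | preQ , postQ , splitQ , preQ∼ , postQ∼ =
      subst₂ Coupling (sym bigP≡) (sym bigQ≡)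
        (run-P preP (All.map proj₁ preP∼)
        (nextQ sP∼sQ (nextQ sP∼sQ*
        (run-Q preQ (All.map proj₁ preQ∼)
        (nextP sP∼bQ (next bP∼bQ
        (append₀ w
        (next eP∼eQ
        (run-Q postQ (All.map proj₂ postQ∼)
        (nextQ tP∼tQ*
        (run-P-to-end tP postP tP∼tQ (All.map proj₂ postP∼))))))))))))
      where
      bigP≡ : bigP Ps ≡ preP ++ (sP ∷ bP ∷ (Ps i ++ eP ∷ tP ∷ postP))
      bigP≡ = trans splitP (cong (λ L → preP ++ (sP ∷ bP ∷ L)) (++-assoc (Ps i) (eP ∷ tP ∷ []) postP))
      bigQ≡ : bigQ Qs ≡ sQ ∷ sQ* ∷ (preQ ++ (bQ ∷ (Qs j ++ eQ ∷ (postQ ++ endQ))))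
      bigQ≡ = cong (λ L → sQ ∷ sQ* ∷ L)
        (trans (cong (_++ endQ) splitQ) (trans (++-assoc preQ _ endQ)
          (cong (λ L → preQ ++ (bQ ∷ L))
            (trans (++-assoc (Qs j ++ eQ ∷ []) postQ endQ) (++-assoc (Qs j) (eQ ∷ []) (postQ ++ endQ))))))

    reduction : ∀ {k} (Ps Qs : Fin k → Curve F) → (∀ ℓ → All InP (Ps ℓ)) → (∀ ℓ → All InQ (Qs ℓ)) →
                DFLe F (bigP Ps) (bigQ Qs) 1# ⇔ ∃₂ λ i j → DFLe F (Ps i) (Qs j) 1#
    reduction Ps Qs innerP innerQ = mk⇔ sound complete
      where
      sound : DFLe F (bigP Ps) (bigQ Qs) 1# → ∃₂ λ i j → DFLe F (Ps i) (Qs j) 1#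
      sound d with DFLe⇒coupling (bigP Ps) (bigQ Qs) d
      ... | inj₁ (_ , ())
      ... | inj₂ w with couple-inner Ps Qs innerP innerQ w
      ...   | i , j , wᵢⱼ = i , j , coupling⇒DFLe wᵢⱼ
      complete : (∃₂ λ i j → DFLe F (Ps i) (Qs j) 1#) → DFLe F (bigP Ps) (bigQ Qs) 1#
      complete (i , j , d) =
        coupling⇒DFLe (inj₂ (couple-outer Ps Qs innerP innerQ i j (DFLe⇒coupling (Ps i) (Qs j) d)))

module Geometry (F : OrderedField) where
  open Arithmetic F
  open Couplings F 1# using (Close)

  PolyPoint : ℕ → Set
  PolyPoint k = Polynomial k × Polynomial k

  ⟦_⟧ₚ : ∀ {k} → PolyPoint k → Vec Carrier k → Point F
  ⟦ x , y ⟧ₚ ρ = ⟦ x ⟧ ρ , ⟦ y ⟧ ρ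

  sqDistₚ : ∀ {k} → PolyPoint k → PolyPoint k → Polynomial k
  sqDistₚ (x₁ , y₁) (x₂ , y₂) = (x₁ :- x₂) :* (x₁ :- x₂) :+ (y₁ :- y₂) :* (y₁ :- y₂)

  module Vertices {k} (h d : Polynomial k) where
    sP tP bP eP sQ tQ sQ* tQ* bQ eQ : PolyPoint k
    sP  = :- h , κ 1 :- d :* d
    tP  = h    , κ 1 :- d :* d
    bP  = :- h , κ 1
    eP  = h    , κ 1
    sQ  = :- h , d :* d
    tQ  = h    , d :* d
    sQ* = :- h , :- (d :* d)
    tQ* = h    , :- (d :* d)
    bQ  = :- h , κ 0
    eQ  = h    , κ 0

  private
    module V = Vertices {2} (var zero) (var (suc zero))
    at : Carrier → Carrier → PolyPoint 2 → Point F
    at h d p = ⟦ p ⟧ₚ (h ∷ d ∷ [])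

  -- The curves of the construction for half-width h and depth d; the
  -- curves of `Construction F δ` are those of `GadgetAt (half δ) δ`.
  module GadgetAt (h d : Carrier) = Gadget F
    (at h d V.sP) (at h d V.tP) (at h d V.bP) (at h d V.eP) (at h d V.sQ)
    (at h d V.tQ) (at h d V.sQ*) (at h d V.tQ*) (at h d V.bQ) (at h d V.eQ)

  Claim : ∀ {k} → (Fin k → Curve F) → (Fin k → Curve F) → Carrier → Carrier → Set
  Claim Ps Qs h d = let open GadgetAt h d in
    Placed F d (bigP Ps) (bigQ Qs) × (DFLe F (bigP Ps) (bigQ Qs) 1# ⇔ ∃₂ λ i j → DFLe F (Ps i) (Qs j) 1#)

  module CertifiedDistances {k n} (ρ : Vec Carrier k) (atoms : Vec (Polynomial k) n)
                            (atoms-nonneg : VecAll (λ a → 0# ≤ ⟦ a ⟧ ρ) atoms) where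
    open Certified ρ atoms atoms-nonneg public

    close-by : ∀ p q c → ⟦ sqDistₚ p q :+ ⌜ c ⌝ ⟧↓ ρ ≡ ⟦ κ 1 :* κ 1 ⟧↓ ρ →
               Close (⟦ p ⟧ₚ ρ) (⟦ q ⟧ₚ ρ)
    close-by p q = ≤-by (sqDistₚ p q) (κ 1 :* κ 1)

    far-by : ∀ t → ¬ ⟦ t ⟧ ρ ≡ 0# → ∀ p q c →
             ⟦ (κ 1 :* κ 1 :+ t :* t) :+ ⌜ c ⌝ ⟧↓ ρ ≡ ⟦ sqDistₚ p q ⟧↓ ρ →
             ¬ Close (⟦ p ⟧ₚ ρ) (⟦ q ⟧ₚ ρ)
    far-by t t≢0 p q c nf = square-gap (⟦ t ⟧ ρ) t≢0 (≤-by (κ 1 :* κ 1 :+ t :* t) (sqDistₚ p q) c nf)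

  -- The construction with half-width h = 4e and depth d = 8e, where
  -- 0 < e ≤ 1/16 (so that d ≤ 1/2).  Here d plays the role of δ, and the
  -- inner curves are e-placed.
  module Normalised (e : Carrier) (0≤e : 0# ≤ e) (e≢0 : ¬ e ≡ 0#) (0≤w : 0# ≤ 1# - ι 16 * e) where
    h d : Carrier
    h = ι 4 * e
    d = ι 8 * e

    module G = GadgetAt h d

    InP InQ : Point F → Set
    InP = InBox F e (1# - e ²) (1# + e ²)
    InQ = InBox F e (- (e ²)) (e ²)

    `e `x `y : Polynomial 3
    `e = var zero
    `x = var (suc zero)
    `y = var (suc (suc zero))

    open Vertices (κ 4 :* `e) (κ 8 :* `e)

    inner : PolyPoint 3
    inner = `x , `y

    -- The certificate atoms: e and 1 - 16e, and for an inner vertex the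
    -- distances x + e, e - x, y - lo, hi - y to the sides of its box.
    ê ŵ : ∀ {n} → Certificate (suc (suc n))
    ê = atom zero
    ŵ = atom (suc zero)

    x⁺ x⁻ y⁺ y⁻ : Certificate 6
    x⁺ = atom (suc (suc zero))
    x⁻ = atom (suc (suc (suc zero)))
    y⁺ = atom (suc (suc (suc (suc zero))))
    y⁻ = atom (suc (suc (suc (suc (suc zero)))))

    infixr 8 _·_
    _·_ : ∀ {n} → ℕ → Certificate n → Certificate n
    m · c = num m ⊗ c

    ê² 1-64e² 1-256e² : ∀ {n} → Certificate (suc (suc n))
    ê² = ê ⊗ ê
    1-64e² = (ŵ ⊕ 8 · ê) ⊗ (num 1 ⊕ 8 · ê)
    1-256e² = ŵ ⊗ (num 1 ⊕ 16 · ê)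

    module Corner = CertifiedDistances (e ∷ 0# ∷ 0# ∷ []) (`e ∷ κ 1 :- κ 16 :* `e ∷ []) (0≤e ∷ 0≤w ∷ [])

    module InnerP (x y : Carrier) (box : InP (x , y)) = CertifiedDistances (e ∷ x ∷ y ∷ [])
      (`e ∷ κ 1 :- κ 16 :* `e ∷ `x :- :- `e ∷ `e :- `x ∷ `y :- (κ 1 :- `e :* `e) ∷ (κ 1 :+ `e :* `e) :- `y ∷ [])
      (0≤e ∷ 0≤w ∷ 0≤-diff (proj₁ (proj₁ box)) ∷ 0≤-diff (proj₂ (proj₁ box))
           ∷ 0≤-diff (proj₁ (proj₂ box)) ∷ 0≤-diff (proj₂ (proj₂ box)) ∷ [])

    module InnerQ (x y : Carrier) (box : InQ (x , y)) = CertifiedDistances (e ∷ x ∷ y ∷ [])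
      (`e ∷ κ 1 :- κ 16 :* `e ∷ `x :- :- `e ∷ `e :- `x ∷ `y :- :- (`e :* `e) ∷ `e :* `e :- `y ∷ [])
      (0≤e ∷ 0≤w ∷ 0≤-diff (proj₁ (proj₁ box)) ∷ 0≤-diff (proj₂ (proj₁ box))
           ∷ 0≤-diff (proj₁ (proj₂ box)) ∷ 0≤-diff (proj₂ (proj₂ box)) ∷ [])

    -- The closeness pattern of the construction, each entry certified by an
    -- explicit decomposition of 1 - |p - q|² (resp. |p - q|² - 1 - e²)
    -- into a nonnegative combination of the atoms.
    closeness : G.Pattern InP InQ
    closeness = record
      { bP≁sQ* = Corner.far-by `e e≢0 bP sQ* (127 · ê² ⊕ 4096 · (ê² ⊗ ê²)) refl
      ; eP≁sQ* = Corner.far-by `e e≢0 eP sQ* (191 · ê² ⊕ 4096 · (ê² ⊗ ê²)) refl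
      ; tP≁sQ* = Corner.far-by `e e≢0 tP sQ* (63 · ê²) refl
      ; p≁sQ* = λ {(x , y)} box → InnerP.far-by x y box `e e≢0 inner sQ*
          (134 · ê² ⊕ 3969 · (ê² ⊗ ê²) ⊕ 6 · ê ⊗ x⁺ ⊕ x⁺ ⊗ x⁺
           ⊕ 2 · (num 1 ⊕ 63 · ê²) ⊗ y⁺ ⊕ y⁺ ⊗ y⁺) refl
      ; sP≁tQ* = Corner.far-by `e e≢0 sP tQ* (63 · ê²) refl
      ; bP≁tQ* = Corner.far-by `e e≢0 bP tQ* (191 · ê² ⊕ 4096 · (ê² ⊗ ê²)) refl
      ; bP≁q = λ {(x , y)} box → InnerQ.far-by x y box `e e≢0 bP inner
          (6 · ê² ⊕ ê² ⊗ ê² ⊕ 6 · ê ⊗ x⁺ ⊕ x⁺ ⊗ x⁺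
           ⊕ 2 · (1-256e² ⊕ 255 · ê²) ⊗ y⁻ ⊕ y⁻ ⊗ y⁻) refl
      ; bP≁eQ = Corner.far-by `e e≢0 bP eQ (63 · ê²) refl
      ; p≁bQ = λ {(x , y)} box → InnerP.far-by x y box `e e≢0 inner bQ
          (6 · ê² ⊕ ê² ⊗ ê² ⊕ 6 · ê ⊗ x⁺ ⊕ x⁺ ⊗ x⁺
           ⊕ 2 · (1-256e² ⊕ 255 · ê²) ⊗ y⁺ ⊕ y⁺ ⊗ y⁺) refl
      ; p≁eQ = λ {(x , y)} box → InnerP.far-by x y box `e e≢0 inner eQ
          (6 · ê² ⊕ ê² ⊗ ê² ⊕ 6 · ê ⊗ x⁻ ⊕ x⁻ ⊗ x⁻
           ⊕ 2 · (1-256e² ⊕ 255 · ê²) ⊗ y⁺ ⊕ y⁺ ⊗ y⁺) refl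
      ; eP≁bQ = Corner.far-by `e e≢0 eP bQ (63 · ê²) refl
      ; eP≁q = λ {(x , y)} box → InnerQ.far-by x y box `e e≢0 eP inner
          (6 · ê² ⊕ ê² ⊗ ê² ⊕ 6 · ê ⊗ x⁻ ⊕ x⁻ ⊗ x⁻
           ⊕ 2 · (1-256e² ⊕ 255 · ê²) ⊗ y⁻ ⊕ y⁻ ⊗ y⁻) refl
      ; sP∼sQ = Corner.close-by sP sQ (256 · ê² ⊗ 1-64e²) refl
      ; bP∼sQ = Corner.close-by bP sQ (128 · ê² ⊗ (1-64e² ⊕ 32 · ê²)) refl
      ; eP∼sQ = Corner.close-by eP sQ (64 · ê² ⊗ 1-64e²) refl
      ; tP∼sQ = Corner.close-by tP sQ (64 · ê² ⊗ (num 2 ⊕ 1-256e²)) refl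
      ; p∼sQ = λ {(x , y)} box → InnerP.close-by x y box inner sQ
          (ê² ⊗ (num 85 ⊕ 16 · 1-256e² ⊕ 127 · ê²) ⊕ 8 · ê ⊗ x⁻
           ⊕ x⁺ ⊗ x⁻ ⊕ (num 1 ⊕ 1-256e² ⊕ 128 · ê²) ⊗ y⁻ ⊕ y⁺ ⊗ y⁻) refl
      ; sP∼tQ = Corner.close-by sP tQ (64 · ê² ⊗ (num 2 ⊕ 1-256e²)) refl
      ; bP∼tQ = Corner.close-by bP tQ (64 · ê² ⊗ 1-64e²) refl
      ; eP∼tQ = Corner.close-by eP tQ (128 · ê² ⊗ (1-64e² ⊕ 32 · ê²)) refl
      ; tP∼tQ = Corner.close-by tP tQ (256 · ê² ⊗ 1-64e²) refl
      ; p∼tQ = λ {(x , y)} box → InnerP.close-by x y box inner tQ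
          (ê² ⊗ (num 85 ⊕ 16 · 1-256e² ⊕ 127 · ê²) ⊕ 8 · ê ⊗ x⁺
           ⊕ x⁻ ⊗ x⁺ ⊕ (num 1 ⊕ 1-256e² ⊕ 128 · ê²) ⊗ y⁻ ⊕ y⁺ ⊗ y⁻) refl
      ; sP∼bQ = Corner.close-by sP bQ (128 · ê² ⊗ (1-64e² ⊕ 32 · ê²)) refl
      ; sP∼eQ = Corner.close-by sP eQ (64 · ê² ⊗ 1-64e²) refl
      ; sP∼q = λ {(x , y)} box → InnerQ.close-by x y box sP inner
          (ê² ⊗ (num 85 ⊕ 16 · 1-256e² ⊕ 127 · ê²) ⊕ 8 · ê ⊗ x⁻
           ⊕ x⁺ ⊗ x⁻ ⊕ (num 1 ⊕ 1-256e² ⊕ 128 · ê²) ⊗ y⁺ ⊕ y⁻ ⊗ y⁺) refl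
      ; tP∼bQ = Corner.close-by tP bQ (64 · ê² ⊗ 1-64e²) refl
      ; tP∼eQ = Corner.close-by tP eQ (128 · ê² ⊗ (1-64e² ⊕ 32 · ê²)) refl
      ; tP∼q = λ {(x , y)} box → InnerQ.close-by x y box tP inner
          (ê² ⊗ (num 85 ⊕ 16 · 1-256e² ⊕ 127 · ê²) ⊕ 8 · ê ⊗ x⁺
           ⊕ x⁻ ⊗ x⁺ ⊕ (num 1 ⊕ 1-256e² ⊕ 128 · ê²) ⊗ y⁺ ⊕ y⁻ ⊗ y⁺) refl
      ; sP∼sQ* = Corner.close-by sP sQ* (num 0) refl
      ; tP∼tQ* = Corner.close-by tP tQ* (num 0) refl
      ; bP∼bQ = Corner.close-by bP bQ (num 0) refl
      ; eP∼eQ = Corner.close-by eP eQ (num 0) refl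
      }

    module Placement where
      D H : Polynomial 3
      D = κ 8 :* `e
      H = κ 4 :* `e
      open Corner using (≤-by)

      -d≤-h : - d ≤ - h
      -d≤-h = ≤-by (:- D) (:- H) (4 · ê) refl
      -h≤d : - h ≤ d
      -h≤d = ≤-by (:- H) D (12 · ê) refl
      -d≤h : - d ≤ h
      -d≤h = ≤-by (:- D) H (12 · ê) refl
      h≤d : h ≤ d
      h≤d = ≤-by H D (4 · ê) refl
      -d≤-e : - d ≤ - e
      -d≤-e = ≤-by (:- D) (:- `e) (7 · ê) refl
      e≤d : e ≤ d
      e≤d = ≤-by `e D (7 · ê) refl

      1-d²≤1+d² : 1# - d ² ≤ 1# + d ²
      1-d²≤1+d² = ≤-by (κ 1 :- D :* D) (κ 1 :+ D :* D) (128 · ê²) refl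
      1-d²≤1 : 1# - d ² ≤ 1#
      1-d²≤1 = ≤-by (κ 1 :- D :* D) (κ 1) (64 · ê²) refl
      1≤1+d² : 1# ≤ 1# + d ²
      1≤1+d² = ≤-by (κ 1) (κ 1 :+ D :* D) (64 · ê²) refl
      1-d²≤1-e² : 1# - d ² ≤ 1# - e ²
      1-d²≤1-e² = ≤-by (κ 1 :- D :* D) (κ 1 :- `e :* `e) (63 · ê²) refl
      1+e²≤1+d² : 1# + e ² ≤ 1# + d ²
      1+e²≤1+d² = ≤-by (κ 1 :+ `e :* `e) (κ 1 :+ D :* D) (63 · ê²) refl
      -d²≤d² : - (d ²) ≤ d ²
      -d²≤d² = ≤-by (:- (D :* D)) (D :* D) (128 · ê²) refl
      -d²≤0 : - (d ²) ≤ 0#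
      -d²≤0 = ≤-by (:- (D :* D)) (κ 0) (64 · ê²) refl
      0≤d² : 0# ≤ d ²
      0≤d² = ≤-by (κ 0) (D :* D) (64 · ê²) refl
      -d²≤-e² : - (d ²) ≤ - (e ²)
      -d²≤-e² = ≤-by (:- (D :* D)) (:- (`e :* `e)) (63 · ê²) refl
      e²≤d² : e ² ≤ d ²
      e²≤d² = ≤-by (`e :* `e) (D :* D) (63 · ê²) refl

      BoxP BoxQ : Point F → Set
      BoxP = InBox F d (1# - d ²) (1# + d ²)
      BoxQ = InBox F d (- (d ²)) (d ²)

      at-left : - d ≤ - h × - h ≤ d
      at-left = -d≤-h , -h≤d
      at-right : - d ≤ h × h ≤ d
      at-right = -d≤h , h≤d
      at-1-d² : 1# - d ² ≤ 1# - d ² × 1# - d ² ≤ 1# + d ²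
      at-1-d² = ≤-refl , 1-d²≤1+d²
      at-1 : 1# - d ² ≤ 1# × 1# ≤ 1# + d ²
      at-1 = 1-d²≤1 , 1≤1+d²
      at-d² : - (d ²) ≤ d ² × d ² ≤ d ²
      at-d² = -d²≤d² , ≤-refl
      at--d² : - (d ²) ≤ - (d ²) × - (d ²) ≤ d ²
      at--d² = ≤-refl , -d²≤d²
      at-0 : - (d ²) ≤ 0# × 0# ≤ d ²
      at-0 = -d²≤0 , 0≤d²

      InP⊆BoxP : ∀ {p} → InP p → BoxP p
      InP⊆BoxP {x , y} ((-e≤x , x≤e) , (lo≤y , y≤hi)) =
        (≤-trans -d≤-e -e≤x , ≤-trans x≤e e≤d) , (≤-trans 1-d²≤1-e² lo≤y , ≤-trans y≤hi 1+e²≤1+d²)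

      InQ⊆BoxQ : ∀ {q} → InQ q → BoxQ q
      InQ⊆BoxQ {x , y} ((-e≤x , x≤e) , (lo≤y , y≤hi)) =
        (≤-trans -d≤-e -e≤x , ≤-trans x≤e e≤d) , (≤-trans -d²≤-e² lo≤y , ≤-trans y≤hi e²≤d²)

    placement : ∀ {k} (Ps Qs : Fin k → Curve F) → (∀ ℓ → Placed F e (Ps ℓ) (Qs ℓ)) →
                Placed F d (G.bigP Ps) (G.bigQ Qs)
    placement Ps Qs placed =
      concat⁺ (tabulate⁺ λ ℓ →
        (at-left , at-1-d²) ∷ (at-left , at-1) ∷
        ++⁺ (All.map InP⊆BoxP (proj₁ (placed ℓ))) ((at-right , at-1) ∷ (at-right , at-1-d²) ∷ [])) ,
      (at-left , at-d²) ∷ (at-left , at--d²) ∷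
      ++⁺ (concat⁺ (tabulate⁺ λ ℓ →
             (at-left , at-0) ∷ ++⁺ (All.map InQ⊆BoxQ (proj₂ (placed ℓ))) ((at-right , at-0) ∷ [])))
          ((at-right , at--d²) ∷ (at-right , at-d²) ∷ [])
      where open Placement

    claim : ∀ {k} (Ps Qs : Fin k → Curve F) → (∀ ℓ → Placed F e (Ps ℓ) (Qs ℓ)) → Claim Ps Qs h d
    claim Ps Qs placed =
      placement Ps Qs placed , G.reduction closeness Ps Qs (proj₁ ∘ placed) (proj₂ ∘ placed)

  module Scaling (δ : Carrier) (0<δ : 0# < δ) (δ≤½ : δ ≤ half 1#) where
    e : Carrier
    e = eighth δ

    private
      1+a≢0 : ∀ {a} → 0# ≤ a → ¬ 1# + a ≡ 0#
      1+a≢0 {a} 0≤a 1+a≡0 = 0≢1 (antisym 0≤1 (subst (1# ≤_) 1+a≡0 (≤-by-slack a refl 0≤a)))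

      2≢0 : ¬ 2# ≡ 0#
      2≢0 = 1+a≢0 0≤1

      8≡ι8 : 8# ≡ ι 8
      8≡ι8 = solve 0 ((κ 1 :+ κ 1) :* (κ 1 :+ κ 1) :* (κ 1 :+ κ 1) := κ 8) refl

      8≢0 : ¬ 8# ≡ 0#
      8≢0 8≡0 = 1+a≢0 (0≤ι 7) (trans (solve 0 (κ 1 :+ κ 7 := κ 8) refl) (trans (sym 8≡ι8) 8≡0))

    δ≡8e : δ ≡ ι 8 * e
    δ≡8e = sym (begin
      ι 8 * (δ * inv 8#)    ≡⟨ solve 3 (λ c x y → c :* (x :* y) := x :* (c :* y)) refl (ι 8) δ (inv 8#) ⟩
      δ * (ι 8 * inv 8#)    ≡⟨ cong (λ c → δ * (c * inv 8#)) (sym 8≡ι8) ⟩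
      δ * (8# * inv 8#)     ≡⟨ cong (δ *_) (inv-correct 8# 8≢0) ⟩
      δ * 1#                ≡⟨ *-identityʳ δ ⟩
      δ                     ∎)
      where open ≡-Reasoning

    half-δ≡4e : half δ ≡ ι 4 * e
    half-δ≡4e = begin
      δ * inv 2#                  ≡⟨ cong (_* inv 2#) δ≡8e ⟩
      (ι 8 * e) * inv 2#          ≡⟨ solve 2 (λ x y → (κ 8 :* x) :* y := (κ 4 :* x) :* ((κ 1 :+ κ 1) :* y)) refl e (inv 2#) ⟩
      (ι 4 * e) * (2# * inv 2#)   ≡⟨ cong ((ι 4 * e) *_) (inv-correct 2# 2≢0) ⟩
      (ι 4 * e) * 1#              ≡⟨ *-identityʳ _ ⟩
      ι 4 * e                     ∎
      where open ≡-Reasoning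

    e≢0 : ¬ e ≡ 0#
    e≢0 e≡0 = proj₂ 0<δ (sym (trans δ≡8e (trans (cong (ι 8 *_) e≡0) (zeroʳ (ι 8)))))

    0≤e : 0# ≤ e
    0≤e with total 0# e
    ... | inj₁ 0≤e = 0≤e
    ... | inj₂ e≤0 = ⊥-elim (proj₂ 0<δ (antisym (proj₁ 0<δ) δ≤0))
      where
      δ≤0 : δ ≤ 0#
      δ≤0 = ≤-by-slack (ι 8 * (0# - e))
              (trans (cong (_+ ι 8 * (0# - e)) δ≡8e)
                     (solve 1 (λ x → κ 8 :* x :+ κ 8 :* (κ 0 :- x) := κ 0) refl e))
              (*-nonneg _ _ (0≤ι 8) (0≤-diff e≤0))

    0≤1-16e : 0# ≤ 1# - ι 16 * e
    0≤1-16e = subst (0# ≤_) 2[½-δ]≡1-16e (*-nonneg _ _ (0≤ι 2) (0≤-diff δ≤½))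
      where
      open ≡-Reasoning
      2[½-δ]≡1-16e : ι 2 * (1# * inv 2# - δ) ≡ 1# - ι 16 * e
      2[½-δ]≡1-16e = begin
        ι 2 * (1# * inv 2# - δ)       ≡⟨ cong (λ x → ι 2 * (1# * inv 2# - x)) δ≡8e ⟩
        ι 2 * (1# * inv 2# - ι 8 * e) ≡⟨ solve 2 (λ x y → κ 2 :* (κ 1 :* y :- κ 8 :* x) := (κ 1 :+ κ 1) :* y :- κ 16 :* x) refl e (inv 2#) ⟩
        2# * inv 2# - ι 16 * e        ≡⟨ cong (_- ι 16 * e) (inv-correct 2# 2≢0) ⟩
        1# - ι 16 * e                 ∎

-- The construction of `Construction F δ` is the normalised one for e = δ/8,
-- with half-width δ/2 = 4e and depth δ = 8e.
lemmaF3 : (F : OrderedField) → let open OrderedField F in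
    (δ : Carrier) → 0# < δ → δ ≤ half 1# →
    (k : ℕ) (Ps Qs : Fin k → Curve F) →
    (∀ ℓ → Placed F (eighth δ) (Ps ℓ) (Qs ℓ)) →
    let open Construction F δ in
      Placed F δ (bigP Ps) (bigQ Qs)
      × (DFLe F (bigP Ps) (bigQ Qs) 1# ⇔ ∃₂ λ i j → DFLe F (Ps i) (Qs j) 1#)
lemmaF3 F δ 0<δ δ≤½ k Ps Qs placed =
  subst₂ (Claim Ps Qs) (sym half-δ≡4e) (sym δ≡8e) (Normalised.claim e 0≤e e≢0 0≤1-16e Ps Qs placed)
  where
  open Geometry F
  open Scaling δ 0<δ δ≤½
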